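{- Let $G$ be a finite, connected, undirected multigraph without loops with $n$ vertices, Laplacian $L$, reduced Laplacian $\tilde L$, and let $m=|\mathrm{Jac}(G)|$. Let $w\in\mathbb{Z}^n$ and let $\tilde w\in\mathbb{Z}^{n-1}$ be the vector of the first $n-1$ entries of $w-w_n\mathbf{1}$ (where $\mathbf{1}$ is the all-ones vector). Then $w$ is a monodromy weight if and only if $\tilde L\tilde w\equiv 0\pmod m$.
   Context: Vertices are indexed $v_1,\dots,v_n$. A divisor is a vector in $\mathbb{Z}^n$; $\mathrm{Div}^0(G)$ is the group of divisors with entry sum $0$. The Laplacian is $L=\Delta-A$, where $\Delta$ is the diagonal matrix of valencies and $A_{ij}$ is the number of edges between $v_i$ and $v_j$; the reduced Laplacian $\tilde L$ is $L$ with its $n$-th row and $n$-th column deleted. Principal divisors are the vectors $L\sigma$, $\sigma\in\mathbb{Z}^n$, and $\mathrm{Jac}(G)=\mathrm{Div}^0(G)/\{L\sigma\}$. A vector $w\in\mathbb{Z}^n$ is a monodromy weight if $w\cdot D\equiv 0\pmod m$ for all principal divisors $D$. -}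

module Defs where

open import Data.Nat as ℕ using (ℕ; zero; suc)
open import Data.Integer as ℤ using (ℤ; +_; _+_; _*_; _-_)
open import Data.Integer.Divisibility using (_∣_)
open import Data.Fin using (Fin; fromℕ; inject₁; _≟_)
open import Data.Product using (Σ; ∃; _×_)
open import Relation.Nullary using (¬_; yes; no)
open import Relation.Binary.PropositionalEquality using (_≡_; _≢_)

Σℤ : ∀ {n} → (Fin n → ℤ) → ℤ
Σℤ {zero}  f = + 0
Σℤ {suc n} f = f Fin.zero + Σℤ (λ i → f (Fin.suc i))
  where import Data.Fin as Fin

-- A finite undirected loopless multigraph on vertices Fin n,
-- given by its adjacency matrix A (A i j = number of edges between i and j).
record Multigraph (n : ℕ) : Set where
  field
    adj       : Fin n → Fin n → ℕ
    symmetric : ∀ i j → adj i j ≡ adj j i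
    loopless  : ∀ i → adj i i ≡ 0
open Multigraph public

data Walk {n : ℕ} (G : Multigraph n) : Fin n → Fin n → Set where
  here : ∀ {i} → Walk G i i
  step : ∀ {i k j} → 0 ℕ.< adj G i k → Walk G k j → Walk G i j

Connected : ∀ {n} → Multigraph n → Set
Connected G = ∀ i j → Walk G i j

Divisor : ℕ → Set
Divisor n = Fin n → ℤ

valency : ∀ {n} → Multigraph n → Fin n → ℤ
valency G i = Σℤ (λ j → + adj G i j)

laplacian : ∀ {n} → Multigraph n → Fin n → Fin n → ℤ
laplacian G i j with i ≟ j
... | yes _ = valency G i - + adj G i j
... | no  _ = + 0 - + adj G i j

_·ᴹ_ : ∀ {a b} → (Fin a → Fin b → ℤ) → (Fin b → ℤ) → Fin a → ℤ
(M ·ᴹ v) i = Σℤ (λ j → M i j * v j)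

dot : ∀ {n} → (Fin n → ℤ) → (Fin n → ℤ) → ℤ
dot v u = Σℤ (λ i → v i * u i)

deg : ∀ {n} → Divisor n → ℤ
deg D = Σℤ D

InDiv0 : ∀ {n} → Divisor n → Set
InDiv0 D = deg D ≡ + 0

principal : ∀ {n} → Multigraph n → (Fin n → ℤ) → Divisor n
principal G σ = laplacian G ·ᴹ σ

LinEquiv : ∀ {n} → Multigraph n → Divisor n → Divisor n → Set
LinEquiv G D D' = ∃ λ σ → ∀ i → D i - D' i ≡ principal G σ i

-- m = |Jac(G)| = |Div⁰(G) / {Lσ}| : there are m representatives in Div⁰,
-- pairwise inequivalent, such that every degree-0 divisor is equivalent to one of them.
JacOrder : ∀ {n} → Multigraph n → ℕ → Set
JacOrder {n} G m =
  Σ (Fin m → Divisor n) λ rep →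
    (∀ a → InDiv0 (rep a))
    × (∀ a b → a ≢ b → ¬ LinEquiv G (rep a) (rep b))
    × (∀ D → InDiv0 D → ∃ λ a → LinEquiv G D (rep a))

MonodromyWeight : ∀ {n} → Multigraph n → ℕ → (Fin n → ℤ) → Set
MonodromyWeight G m w = ∀ σ → (+ m) ∣ dot w (principal G σ)

reducedLaplacian : ∀ {k} → Multigraph (suc k) → Fin k → Fin k → ℤ
reducedLaplacian G i j = laplacian G (inject₁ i) (inject₁ j)

reducedWeight : ∀ {k} → (Fin (suc k) → ℤ) → Fin k → ℤ
reducedWeight {k} w i = w (inject₁ i) - w (fromℕ k)

-- The Laplacian L is symmetric with zero row sums, so w · Lσ = σ · Lw for all σ, and testing on the
-- unit vectors shows that w is a monodromy weight iff every entry of Lw is divisible by m. Adding a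
-- constant vector to w does not change Lw, and w − wₙ𝟙 vanishes at vₙ, so the first n − 1 entries of
-- Lw are exactly L̃w̃. The last entry of Lw is minus the sum of the others, because the column sums of
-- L vanish as well.
module Submission where

open import Defs
open import Data.Nat using (ℕ; suc; zero)
open import Data.Integer using (ℤ; +_; _+_; _*_; _-_; -_)
open import Data.Integer.Divisibility using (_∣_)
open import Data.Fin using (Fin; zero; suc; inject₁; fromℕ; _≟_)
open import Function.Bundles using (_⇔_; mk⇔)

open import Data.Empty using (⊥-elim)
open import Data.Fin.Induction using (>-weakInduction)
open import Data.Integer.Properties
  using (+-*-semiring; +-identityˡ; +-identityʳ; +-inverseʳ; *-identityˡ; *-zeroʳ; neg-distrib-+)
open import Algebra.Properties.Semiring.Sum +-*-semiring
  using (sum; sum-cong-≗; ∑-distrib-+; ∑-comm; *-distribˡ-sum; *-distribʳ-sum; sum-init-last)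
import Data.Integer.Divisibility.Signed as Signed
open Signed using (divides; ∣ᵤ⇒∣; ∣⇒∣ᵤ; ∣m∣n⇒∣m+n; ∣m+n∣m⇒∣n; ∣n⇒∣m*n)
open import Data.Integer.Tactic.RingSolver using (solve-∀)
import Function.Properties.Equivalence as ⇔
open import Relation.Binary.PropositionalEquality
  using (_≡_; _≢_; _≗_; refl; sym; trans; cong; cong₂; subst; module ≡-Reasoning)
open import Relation.Nullary using (yes; no)

Σℤ≡sum : ∀ {n} (f : Fin n → ℤ) → Σℤ f ≡ sum f
Σℤ≡sum {zero}  f = refl
Σℤ≡sum {suc n} f = cong (_+_ (f zero)) (Σℤ≡sum (λ i → f (suc i)))

Σℤ-cong : ∀ {n} {f g : Fin n → ℤ} → f ≗ g → Σℤ f ≡ Σℤ g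
Σℤ-cong {f = f} {g} f≗g = trans (Σℤ≡sum f) (trans (sum-cong-≗ f≗g) (sym (Σℤ≡sum g)))

Σℤ-zero : ∀ {n} → Σℤ {n} (λ _ → + 0) ≡ + 0
Σℤ-zero {zero}  = refl
Σℤ-zero {suc n} = trans (+-identityˡ _) (Σℤ-zero {n})

Σℤ-distrib-+ : ∀ {n} (f g : Fin n → ℤ) → Σℤ (λ i → f i + g i) ≡ Σℤ f + Σℤ g
Σℤ-distrib-+ f g = trans (Σℤ≡sum (λ i → f i + g i))
  (trans (∑-distrib-+ f g) (sym (cong₂ _+_ (Σℤ≡sum f) (Σℤ≡sum g))))

Σℤ-neg : ∀ {n} (f : Fin n → ℤ) → Σℤ (λ i → - f i) ≡ - Σℤ f
Σℤ-neg {zero}  f = refl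
Σℤ-neg {suc n} f =
  trans (cong (_+_ (- f zero)) (Σℤ-neg (λ i → f (suc i)))) (sym (neg-distrib-+ (f zero) _))

Σℤ-distrib-- : ∀ {n} (f g : Fin n → ℤ) → Σℤ (λ i → f i - g i) ≡ Σℤ f - Σℤ g
Σℤ-distrib-- f g = trans (Σℤ-distrib-+ f (λ i → - g i)) (cong (_+_ (Σℤ f)) (Σℤ-neg g))

*-distribˡ-Σℤ : ∀ {n} c (f : Fin n → ℤ) → c * Σℤ f ≡ Σℤ (λ i → c * f i)
*-distribˡ-Σℤ c f =
  trans (cong (c *_) (Σℤ≡sum f)) (trans (*-distribˡ-sum c f) (sym (Σℤ≡sum (λ i → c * f i))))

*-distribʳ-Σℤ : ∀ {n} c (f : Fin n → ℤ) → Σℤ f * c ≡ Σℤ (λ i → f i * c)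
*-distribʳ-Σℤ c f =
  trans (cong (_* c) (Σℤ≡sum f)) (trans (*-distribʳ-sum c f) (sym (Σℤ≡sum (λ i → f i * c))))

Σℤ-comm : ∀ {m n} (f : Fin m → Fin n → ℤ) →
  Σℤ (λ i → Σℤ (λ j → f i j)) ≡ Σℤ (λ j → Σℤ (λ i → f i j))
Σℤ-comm f = trans (Σℤ²≡sum² f) (trans (∑-comm f) (sym (Σℤ²≡sum² (λ j i → f i j))))
  where
  Σℤ²≡sum² : ∀ {m n} (g : Fin m → Fin n → ℤ) →
    Σℤ (λ i → Σℤ (λ j → g i j)) ≡ sum (λ i → sum (λ j → g i j))
  Σℤ²≡sum² g = trans (Σℤ-cong (λ i → Σℤ≡sum (g i))) (Σℤ≡sum (λ i → sum (g i)))

Σℤ-init-last : ∀ {k} (f : Fin (suc k) → ℤ) → Σℤ f ≡ Σℤ (λ i → f (inject₁ i)) + f (fromℕ k)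
Σℤ-init-last {k} f = trans (Σℤ≡sum f)
  (trans (sum-init-last f) (cong (_+ f (fromℕ k)) (sym (Σℤ≡sum (λ i → f (inject₁ i))))))

∣-Σℤ : ∀ {n} {d} (f : Fin n → ℤ) → (∀ i → d Signed.∣ f i) → d Signed.∣ Σℤ f
∣-Σℤ {zero}  f d∣f = divides (+ 0) refl
∣-Σℤ {suc n} f d∣f = ∣m∣n⇒∣m+n (d∣f zero) (∣-Σℤ (λ i → f (suc i)) (λ i → d∣f (suc i)))

∣-last-of-Σℤ≡0 : ∀ {k} {d} (f : Fin (suc k) → ℤ) → Σℤ f ≡ + 0 →
  (∀ i → d Signed.∣ f (inject₁ i)) → d Signed.∣ f (fromℕ k)
∣-last-of-Σℤ≡0 {k} {d} f Σf≡0 d∣init = ∣m+n∣m⇒∣n d∣Σf (∣-Σℤ (λ i → f (inject₁ i)) d∣init)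
  where
  d∣Σf : d Signed.∣ Σℤ (λ i → f (inject₁ i)) + f (fromℕ k)
  d∣Σf = subst (d Signed.∣_) (trans (sym Σf≡0) (Σℤ-init-last f)) (divides (+ 0) refl)

δ : ∀ {n} → Fin n → Fin n → ℤ
δ zero    zero    = + 1
δ zero    (suc _) = + 0
δ (suc _) zero    = + 0
δ (suc i) (suc j) = δ i j

δ-refl : ∀ {n} (i : Fin n) → δ i i ≡ + 1
δ-refl zero    = refl
δ-refl (suc i) = δ-refl i

δ-≢ : ∀ {n} {i j : Fin n} → i ≢ j → δ i j ≡ + 0
δ-≢ {i = zero}  {zero}  i≢j = ⊥-elim (i≢j refl)
δ-≢ {i = zero}  {suc j} i≢j = refl
δ-≢ {i = suc i} {zero}  i≢j = refl
δ-≢ {i = suc i} {suc j} i≢j = δ-≢ (λ i≡j → i≢j (cong suc i≡j))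

Σℤ-δ : ∀ {n} (i : Fin n) (f : Fin n → ℤ) → Σℤ (λ j → δ i j * f j) ≡ f i
Σℤ-δ {suc n} zero    f = trans (cong₂ _+_ (*-identityˡ (f zero)) (Σℤ-zero {n})) (+-identityʳ (f zero))
Σℤ-δ (suc i) f = trans (+-identityˡ _) (Σℤ-δ i (λ j → f (suc j)))

module _ {n} (G : Multigraph n) where

  private
    L = laplacian G

  laplacian≡δ-adj : ∀ i j → L i j ≡ δ i j * valency G i - + adj G i j
  laplacian≡δ-adj i j with i ≟ j
  ... | yes refl = cong (_- + adj G i i)
                     (sym (trans (cong (_* valency G i) (δ-refl i)) (*-identityˡ _)))
  ... | no i≢j   = cong (_- + adj G i j) (sym (cong (_* valency G i) (δ-≢ i≢j)))

  laplacian-sym : ∀ i j → L i j ≡ L j i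
  laplacian-sym i j with i ≟ j | j ≟ i
  ... | yes refl | yes _    = refl
  ... | yes refl | no j≢i   = ⊥-elim (j≢i refl)
  ... | no i≢j   | yes refl = ⊥-elim (i≢j refl)
  ... | no _     | no _     = cong (λ a → + 0 - + a) (symmetric G i j)

  Σℤ-laplacian-row : ∀ i → Σℤ (L i) ≡ + 0
  Σℤ-laplacian-row i = begin
    Σℤ (L i)                                                  ≡⟨ Σℤ-cong (laplacian≡δ-adj i) ⟩
    Σℤ (λ j → δ i j * valency G i - + adj G i j)              ≡⟨ Σℤ-distrib-- _ (λ j → + adj G i j) ⟩
    Σℤ (λ j → δ i j * valency G i) - valency G i              ≡⟨ cong (_- valency G i) (Σℤ-δ i _) ⟩
    valency G i - valency G i                                 ≡⟨ +-inverseʳ (valency G i) ⟩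
    + 0                                                       ∎
    where open ≡-Reasoning

  Σℤ-laplacian-col : ∀ j → Σℤ (λ i → L i j) ≡ + 0
  Σℤ-laplacian-col j = trans (Σℤ-cong (λ i → laplacian-sym i j)) (Σℤ-laplacian-row j)

  dot-principal : ∀ (w σ : Fin n → ℤ) → dot w (principal G σ) ≡ dot σ (L ·ᴹ w)
  dot-principal w σ = begin
    Σℤ (λ i → w i * Σℤ (λ j → L i j * σ j))
      ≡⟨ Σℤ-cong (λ i → *-distribˡ-Σℤ (w i) (λ j → L i j * σ j)) ⟩
    Σℤ (λ i → Σℤ (λ j → w i * (L i j * σ j)))
      ≡⟨ Σℤ-comm (λ i j → w i * (L i j * σ j)) ⟩
    Σℤ (λ j → Σℤ (λ i → w i * (L i j * σ j)))
      ≡⟨ Σℤ-cong (λ j → Σℤ-cong (λ i → transpose i j)) ⟩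
    Σℤ (λ j → Σℤ (λ i → σ j * (L j i * w i)))
      ≡⟨ Σℤ-cong (λ j → sym (*-distribˡ-Σℤ (σ j) (λ i → L j i * w i))) ⟩
    Σℤ (λ j → σ j * Σℤ (λ i → L j i * w i))
      ∎
    where
    open ≡-Reasoning
    rearrange : ∀ a b c → a * (b * c) ≡ c * (b * a)
    rearrange = solve-∀
    transpose : ∀ i j → w i * (L i j * σ j) ≡ σ j * (L j i * w i)
    transpose i j =
      trans (rearrange (w i) (L i j) (σ j)) (cong (λ a → σ j * (a * w i)) (laplacian-sym i j))

  laplacian-·ᴹ-shift : ∀ (w : Fin n → ℤ) c i → (L ·ᴹ (λ j → w j - c)) i ≡ (L ·ᴹ w) i
  laplacian-·ᴹ-shift w c i = begin
    Σℤ (λ j → L i j * (w j - c))                  ≡⟨ Σℤ-cong (λ j → *-distribˡ-- (L i j) (w j) c) ⟩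
    Σℤ (λ j → L i j * w j - L i j * c)            ≡⟨ Σℤ-distrib-- (λ j → L i j * w j) (λ j → L i j * c) ⟩
    (L ·ᴹ w) i - Σℤ (λ j → L i j * c)             ≡⟨ cong (λ a → (L ·ᴹ w) i - a) Σℤ[Lc]≡0 ⟩
    (L ·ᴹ w) i + + 0                              ≡⟨ +-identityʳ _ ⟩
    (L ·ᴹ w) i                                    ∎
    where
    open ≡-Reasoning
    *-distribˡ-- : ∀ a b c → a * (b - c) ≡ a * b - a * c
    *-distribˡ-- = solve-∀
    Σℤ[Lc]≡0 : Σℤ (λ j → L i j * c) ≡ + 0
    Σℤ[Lc]≡0 = trans (sym (*-distribʳ-Σℤ c (L i))) (cong (_* c) (Σℤ-laplacian-row i))

  Σℤ-laplacian-·ᴹ : ∀ (w : Fin n → ℤ) → Σℤ (L ·ᴹ w) ≡ + 0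
  Σℤ-laplacian-·ᴹ w = begin
    Σℤ (λ i → Σℤ (λ j → L i j * w j))   ≡⟨ Σℤ-comm (λ i j → L i j * w j) ⟩
    Σℤ (λ j → Σℤ (λ i → L i j * w j))   ≡⟨ Σℤ-cong (λ j → sym (*-distribʳ-Σℤ (w j) (λ i → L i j))) ⟩
    Σℤ (λ j → Σℤ (λ i → L i j) * w j)   ≡⟨ Σℤ-cong (λ j → cong (_* w j) (Σℤ-laplacian-col j)) ⟩
    Σℤ {n} (λ _ → + 0)                  ≡⟨ Σℤ-zero {n} ⟩
    + 0                                 ∎
    where open ≡-Reasoning

  monodromyWeight⇔∣-laplacian : ∀ m (w : Fin n → ℤ) →
    MonodromyWeight G m w ⇔ (∀ i → + m ∣ (L ·ᴹ w) i)
  monodromyWeight⇔∣-laplacian m w = mk⇔ to from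
    where
    to : MonodromyWeight G m w → ∀ i → + m ∣ (L ·ᴹ w) i
    to weight i = subst (+ m ∣_) (trans (dot-principal w (δ i)) (Σℤ-δ i (L ·ᴹ w))) (weight (δ i))
    from : (∀ i → + m ∣ (L ·ᴹ w) i) → MonodromyWeight G m w
    from m∣Lw σ = ∣⇒∣ᵤ (subst (+ m Signed.∣_) (sym (dot-principal w σ))
                     (∣-Σℤ _ (λ i → ∣n⇒∣m*n (σ i) (∣ᵤ⇒∣ (m∣Lw i)))))

module _ {k} (G : Multigraph (suc k)) where

  private
    L = laplacian G

  laplacian-·ᴹ-inject₁ : ∀ (w : Fin (suc k) → ℤ) j →
    (L ·ᴹ w) (inject₁ j) ≡ (reducedLaplacian G ·ᴹ reducedWeight w) j
  laplacian-·ᴹ-inject₁ w j = begin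
    (L ·ᴹ w) (inject₁ j)                                ≡⟨ sym (laplacian-·ᴹ-shift G w wₙ (inject₁ j)) ⟩
    Σℤ (λ i → L (inject₁ j) i * (w i - wₙ))             ≡⟨ Σℤ-init-last (λ i → L (inject₁ j) i * (w i - wₙ)) ⟩
    L̃w̃ⱼ + L (inject₁ j) (fromℕ k) * (wₙ - wₙ)           ≡⟨ cong (_+_ L̃w̃ⱼ) last-term≡0 ⟩
    L̃w̃ⱼ + + 0                                           ≡⟨ +-identityʳ L̃w̃ⱼ ⟩
    L̃w̃ⱼ                                                 ∎
    where
    open ≡-Reasoning
    wₙ = w (fromℕ k)
    L̃w̃ⱼ = (reducedLaplacian G ·ᴹ reducedWeight w) j
    last-term≡0 : L (inject₁ j) (fromℕ k) * (wₙ - wₙ) ≡ + 0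
    last-term≡0 =
      trans (cong (L (inject₁ j) (fromℕ k) *_) (+-inverseʳ wₙ)) (*-zeroʳ (L (inject₁ j) (fromℕ k)))

  ∣-laplacian⇔∣-reducedLaplacian : ∀ d (w : Fin (suc k) → ℤ) →
    (∀ i → d ∣ (L ·ᴹ w) i) ⇔ (∀ j → d ∣ (reducedLaplacian G ·ᴹ reducedWeight w) j)
  ∣-laplacian⇔∣-reducedLaplacian d w = mk⇔ to from
    where
    to : (∀ i → d ∣ (L ·ᴹ w) i) → ∀ j → d ∣ (reducedLaplacian G ·ᴹ reducedWeight w) j
    to d∣Lw j = subst (d ∣_) (laplacian-·ᴹ-inject₁ w j) (d∣Lw (inject₁ j))
    from : (∀ j → d ∣ (reducedLaplacian G ·ᴹ reducedWeight w) j) → ∀ i → d ∣ (L ·ᴹ w) i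
    -- The induction is only used as the case split: i is either fromℕ k or some inject₁ j.
    from d∣L̃w̃ = >-weakInduction (λ i → d ∣ (L ·ᴹ w) i)
                  (∣⇒∣ᵤ (∣-last-of-Σℤ≡0 {d = d} (L ·ᴹ w) (Σℤ-laplacian-·ᴹ G w) (λ j → ∣ᵤ⇒∣ (d∣init j))))
                  (λ j _ → d∣init j)
      where
      d∣init : ∀ j → d ∣ (L ·ᴹ w) (inject₁ j)
      d∣init j = subst (d ∣_) (sym (laplacian-·ᴹ-inject₁ w j)) (d∣L̃w̃ j)

proposition2p2 : ∀ {k} (G : Multigraph (suc k)) → Connected G →
    (m : ℕ) → JacOrder G m → (w : Fin (suc k) → ℤ) →
    MonodromyWeight G m w ⇔ (∀ i → (+ m) ∣ (reducedLaplacian G ·ᴹ reducedWeight w) i)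
proposition2p2 G _ m _ w =
  ⇔.trans (monodromyWeight⇔∣-laplacian G m w) (∣-laplacian⇔∣-reducedLaplacian G (+ m) w)
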